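{- Let $\Gamma$ be a typing environment and $\sigma$ a type of system $\mathcal H$. (1) (Soundness) If $a \Vdash \mathtt{T}(\Gamma,\sigma)$ is derivable in the inhabitation algorithm for $\mathcal H$, then for every $\lambda$-term $t$ with $a\le t$ we have $\Gamma\vdash_{\mathcal H} t:\sigma$. (2) (Completeness) If $\Pi\triangleright\Gamma\vdash_{\mathcal H} t:\sigma$, then there exist a term $t'$ with $t\to_\beta^* t'$ and a derivation $\Pi'\triangleright\Gamma\vdash_{\mathcal H} t':\sigma$ such that $t'$ is in $\Pi'$-normal form and $\mathcal A(\Pi')\Vdash \mathtt{T}(\Gamma,\sigma)$ is derivable in the inhabitation algorithm.
   Context: $\lambda$-terms: $t::=x\mid \lambda x.t\mid tu$, modulo renaming of bound variables, with free and bound variables having distinct names and distinct binders binding distinct variables; $\to_\beta$ is the contextual closure of $(\lambda x.t)u\to t\{u/x\}$, $\to_\beta^*$ its reflexive-transitive closure. Types: $\sigma,\tau,\rho::=\alpha\mid A\to\tau$, $\alpha$ ranging over a countable set of base types, and multiset types $A=[\sigma_i]_{i\in I}$ are finite, possibly empty, multisets of types ($[\,]$ is the empty one). A typing environment $\Gamma$ maps variables to multiset types, all but finitely many to $[\,]$; $\mathrm{dom}(\Gamma)=\{x:\Gamma(x)\neq[\,]\}$; $\emptyset$ has empty domain; $(\Gamma+\Delta)(x)=\Gamma(x)\uplus\Delta(x)$ (multiset union), $+_{i\in I}\Delta_i$ its $n$-ary version; $\Gamma\setminus x$ maps $x$ to $[\,]$ and agrees with $\Gamma$ elsewhere; $x_1{:}A_1,\dots,x_n{:}A_n$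 maps $x_i$ to $A_i$ and other variables to $[\,]$. System $\mathcal H$: (var) $x{:}[\rho]\vdash x:\rho$; ($\to$I) from $\Gamma\vdash t:\tau$ infer $\Gamma\setminus x\vdash\lambda x.t:\Gamma(x)\to\tau$; (m) from $(\Delta_i\vdash t:\sigma_i)_{i\in I}$, $I$ finite possibly empty, infer $+_{i\in I}\Delta_i\vdash t:[\sigma_i]_{i\in I}$; ($\to$E) from $\Gamma\vdash t:A\to\tau$ and $\Delta\vdash u:A$ infer $\Gamma+\Delta\vdash tu:\tau$. $\Pi\triangleright J$ means $\Pi$ is a derivation of judgement $J$. The same rules apply to approximate normal forms, the constant $\Omega$ being typable only by (m) with $I=\emptyset$. Approximate normal forms: $a::=\Omega\mid N$, $N::=\lambda x.N\mid L$, $L::=x\mid L\,a$. $\le$ is the smallest order compatible with term constructors with $\Omega\le a$ for all $a$; for a $\lambda$-term $t$, $a\le t$ means $t$ is obtained from $a$ by replacing each occurrence of $\Omega$ by some term. $\bigvee$ is least upper bound for $\le$, and $\uparrow_{i\in I}a_i$ means $\bigvee_{i\in I}a_i$ exists. Typed positions: a position of $t$ is a one-hole context $C$ with $C[u]=t$. For a derivation $\Pi$ with subject $t$, $\mathrm{tocc}(\Pi)$ is: $\{\square\}$ for (var); $\{\square\}\cup\{\lambda x.C: C\in\mathrm{tocc}(\Pi')\}$ for ($\to$I) with premise $\Pi'$; $\{\square\}\cup\{Cv:C\in\mathrm{tocc}(\Pi')\}\cup\{uC:C\in\mathrm{tocc}(\Pi'')\}$ for ($\to$E) with subject $uv$,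 premises $\Pi'$ (for $u$) and $\Pi''$ (for $v$); $\bigcup_{i}\mathrm{tocc}(\Pi_i)$ for (m) with premises $(\Pi_i)_{i\in I}$. $t$ is in $\Pi$-normal form if no subterm at a typed position is a $\beta$-redex. Approximant of $\Pi$ (for $t$ in $\Pi$-normal form): $\mathcal A(\Pi)=x$ for (var); $\lambda x.\mathcal A(\Pi')$ for ($\to$I); $\mathcal A(\Pi')\mathcal A(\Pi'')$ for ($\to$E); $\bigvee_{i\in I}\mathcal A(\Pi_i)$ for (m) ($\Omega$ if $I=\emptyset$). Inhabitation algorithm for $\mathcal H$: a deductive system for judgements $a\Vdash\mathtt T(\Gamma,\sigma)$, $a\Vdash\mathtt{TI}(\Gamma,A)$ and $a\Vdash\mathtt H^{x:[\rho]}(\Gamma,\tau)$, with rules: (Abs) from $a\Vdash\mathtt T(\Gamma+x{:}A,\tau)$ and $x\notin\mathrm{dom}(\Gamma)$ infer $\lambda x.a\Vdash\mathtt T(\Gamma,A\to\tau)$; (Union) from $(a_i\Vdash\mathtt T(\Gamma_i,\sigma_i))_{i\in I}$ and $\uparrow_{i\in I}a_i$ infer $\bigvee_{i\in I}a_i\Vdash\mathtt{TI}(+_{i\in I}\Gamma_i,[\sigma_i]_{i\in I})$; (Head$_{>0}$) from $\Gamma=\Gamma_1+\Gamma_2$, $a\Vdash\mathtt H^{x:[A_1\to\dots\to A_n\to B\to\tau]}(\Gamma_1,B\to\tau)$ and $b\Vdash\mathtt{TI}(\Gamma_2,B)$, $n\ge0$, infer $ab\Vdash\mathtt H^{x:[A_1\to\dots\to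 A_n\to B\to\tau]}(\Gamma,\tau)$; (Head$_0$) $x\Vdash\mathtt H^{x:[\tau]}(\emptyset,\tau)$; (Head) from $a\Vdash\mathtt H^{x:[A_1\to\dots\to A_n\to\tau]}(\Gamma,\tau)$ infer $a\Vdash\mathtt T(\Gamma+x{:}[A_1\to\dots\to A_n\to\tau],\tau)$. -}

module Defs where

open import Data.Nat using (ℕ; zero; suc)
open import Data.Fin using (Fin; zero; suc)
open import Data.List using (List; []; _∷_; _++_; map)
open import Data.List.Relation.Unary.All using (All)
open import Data.List.Relation.Binary.Permutation.Homogeneous using (Permutation)
open import Data.Vec using (Vec; replicate; zipWith; _[_]≔_) renaming ([] to []ᵥ; _∷_ to _∷ᵥ_)
open import Data.Vec.Relation.Binary.Pointwise.Inductive using (Pointwise)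
open import Data.Product using (Σ; ∃; _×_; _,_)
open import Relation.Binary.PropositionalEquality using (_≡_)
open import Relation.Binary.Construct.Closure.ReflexiveTransitive using (Star)
open import Relation.Nullary using (¬_)

-- λ-terms (well-scoped de Bruijn syntax: α-equivalence is syntactic
-- equality; `Tm n` = terms whose free variables are among Fin n)

data Tm (n : ℕ) : Set where
  var : Fin n → Tm n
  ƛ   : Tm (suc n) → Tm n
  _·_ : Tm n → Tm n → Tm n

infixl 7 _·_

Ren : ℕ → ℕ → Set
Ren m n = Fin m → Fin n

ext : ∀ {m n} → Ren m n → Ren (suc m) (suc n)
ext ρ zero    = zero
ext ρ (suc x) = suc (ρ x)

rename : ∀ {m n} → Ren m n → Tm m → Tm n
rename ρ (var x) = var (ρ x)
rename ρ (ƛ t)   = ƛ (rename (ext ρ) t)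
rename ρ (t · u) = rename ρ t · rename ρ u

Sub : ℕ → ℕ → Set
Sub m n = Fin m → Tm n

exts : ∀ {m n} → Sub m n → Sub (suc m) (suc n)
exts σ zero    = var zero
exts σ (suc x) = rename suc (σ x)

subst : ∀ {m n} → Sub m n → Tm m → Tm n
subst σ (var x) = σ x
subst σ (ƛ t)   = ƛ (subst (exts σ) t)
subst σ (t · u) = subst σ t · subst σ u

-- t{u/x}, x being the variable bound by the abstraction
_[_] : ∀ {n} → Tm (suc n) → Tm n → Tm n
_[_] {n} t u = subst σ t
  where
  σ : Sub (suc n) n
  σ zero    = u
  σ (suc x) = var x

data _→β_ {n : ℕ} : Tm n → Tm n → Set where
  β   : ∀ {t u} → ((ƛ t) · u) →β (t [ u ])
  ξƛ  : ∀ {t t'} → t →β t' → ƛ t →β ƛ t'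
  ξ·ₗ : ∀ {t t' u} → t →β t' → (t · u) →β (t' · u)
  ξ·ᵣ : ∀ {t u u'} → u →β u' → (t · u) →β (t · u')

_→β*_ : ∀ {n} → Tm n → Tm n → Set
_→β*_ = Star _→β_

-- Types of system H.  Multiset types are finite lists, considered up to
-- permutation (recursively, inside the types): the relations ≃ / ≃ₘ
-- below are equality of types / multiset types.

data Ty : Set where
  base : ℕ → Ty
  _⇒_  : List Ty → Ty → Ty

infixr 5 _⇒_

MTy : Set
MTy = List Ty

mutual
  data _≃_ : Ty → Ty → Set where
    base≃ : ∀ {α} → base α ≃ base α
    ⇒≃    : ∀ {A B σ τ} → A ≃ₘ B → σ ≃ τ → (A ⇒ σ) ≃ (B ⇒ τ)

  _≃ₘ_ : MTy → MTy → Set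
  A ≃ₘ B = Permutation _≃_ A B

data _≼_ : Ty → Ty → Set where
  here  : ∀ {τ} → τ ≼ τ
  there : ∀ {τ A ρ} → τ ≼ ρ → τ ≼ (A ⇒ ρ)

Env : ℕ → Set
Env n = Vec MTy n

∅ : ∀ {n} → Env n
∅ {n} = replicate n []

_+ₑ_ : ∀ {n} → Env n → Env n → Env n
Γ +ₑ Δ = zipWith _++_ Γ Δ

infixl 6 _+ₑ_

_∶ₑ_ : ∀ {n} → Fin n → MTy → Env n
x ∶ₑ A = ∅ [ x ]≔ A

_≈ₑ_ : ∀ {n} → Env n → Env n → Set
Γ ≈ₑ Δ = Pointwise _≃ₘ_ Γ Δ

-- In (→I) the abstracted variable is the de Bruijn variable 0, so
-- Γ = A ∷ Γ' has Γ(x) = A and Γ \ x = Γ'.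

mutual
  data _⊢_∶_ {n : ℕ} : Env n → Tm n → Ty → Set where
    ax  : ∀ {x ρ} → (x ∶ₑ (ρ ∷ [])) ⊢ var x ∶ ρ
    →I  : ∀ {Γ A t τ} → (A ∷ᵥ Γ) ⊢ t ∶ τ → Γ ⊢ ƛ t ∶ (A ⇒ τ)
    →E  : ∀ {Γ Δ t u A B τ} → Γ ⊢ t ∶ (A ⇒ τ) → Δ ⊢ₘ u ∶ B → A ≃ₘ B →
          (Γ +ₑ Δ) ⊢ t · u ∶ τ

  data _⊢ₘ_∶_ {n : ℕ} : Env n → Tm n → MTy → Set where
    []ₘ  : ∀ {t} → ∅ ⊢ₘ t ∶ []
    _∷ₘ_ : ∀ {Δ Δs t σ A} → Δ ⊢ t ∶ σ → Δs ⊢ₘ t ∶ A → (Δ +ₑ Δs) ⊢ₘ t ∶ (σ ∷ A)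

-- Γ ⊢_H t : σ, read modulo multiset equality of types/environments
Typable : ∀ {n} → Env n → Tm n → Ty → Set
Typable Γ t σ = Σ _ λ Γ' → Σ Ty λ σ' → Γ ≈ₑ Γ' × σ ≃ σ' × (Γ' ⊢ t ∶ σ')

-- Ctx n m : context for terms in scope n with a hole in scope m
data Ctx (n : ℕ) : ℕ → Set where
  □    : Ctx n n
  ƛC   : ∀ {m} → Ctx (suc n) m → Ctx n m
  _·ₗ_ : ∀ {m} → Ctx n m → Tm n → Ctx n m
  _·ᵣ_ : ∀ {m} → Tm n → Ctx n m → Ctx n m

plug : ∀ {n m} → Ctx n m → Tm m → Tm n
plug □        u = u
plug (ƛC C)   u = ƛ (plug C u)
plug (C ·ₗ v) u = plug C u · v
plug (v ·ᵣ C) u = v · plug C u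

mutual
  data TOcc {n : ℕ} : ∀ {Γ t σ} → Γ ⊢ t ∶ σ → ∀ {m} → Ctx n m → Set where
    here  : ∀ {Γ t σ} {Π : Γ ⊢ t ∶ σ} → TOcc Π □
    inƛ   : ∀ {Γ A t τ} {Π : (A ∷ᵥ Γ) ⊢ t ∶ τ} {m} {C : Ctx (suc n) m} →
            TOcc Π C → TOcc (→I {Γ = Γ} Π) (ƛC C)
    inFun : ∀ {Γ Δ t u A B τ} {Π : Γ ⊢ t ∶ (A ⇒ τ)} {Πs : Δ ⊢ₘ u ∶ B} {e : A ≃ₘ B}
            {m} {C : Ctx n m} → TOcc Π C → TOcc (→E Π Πs e) (C ·ₗ u)
    inArg : ∀ {Γ Δ t u A B τ} {Π : Γ ⊢ t ∶ (A ⇒ τ)} {Πs : Δ ⊢ₘ u ∶ B} {e : A ≃ₘ B}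
            {m} {C : Ctx n m} → TOccₘ Πs C → TOcc (→E Π Πs e) (t ·ᵣ C)

  data TOccₘ {n : ℕ} : ∀ {Γ t A} → Γ ⊢ₘ t ∶ A → ∀ {m} → Ctx n m → Set where
    inHd : ∀ {Δ Δs t σ A} {Π : Δ ⊢ t ∶ σ} {Πs : Δs ⊢ₘ t ∶ A} {m} {C : Ctx n m} →
           TOcc Π C → TOccₘ (Π ∷ₘ Πs) C
    inTl : ∀ {Δ Δs t σ A} {Π : Δ ⊢ t ∶ σ} {Πs : Δs ⊢ₘ t ∶ A} {m} {C : Ctx n m} →
           TOccₘ Πs C → TOccₘ (Π ∷ₘ Πs) C

IsRedex : ∀ {n} → Tm n → Set
IsRedex u = Σ _ λ s → Σ _ λ v → u ≡ (ƛ s · v)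

ΠNormal : ∀ {n Γ t σ} → Γ ⊢ t ∶ σ → Set
ΠNormal {n} {t = t} Π =
  ∀ {m} (C : Ctx n m) (u : Tm m) → TOcc Π C → plug C u ≡ t → ¬ IsRedex u

mutual
  data Apx (n : ℕ) : Set where
    Ω  : Apx n
    nf : Nf n → Apx n

  data Nf (n : ℕ) : Set where
    ƛN  : Nf (suc n) → Nf n
    neu : Ne n → Nf n

  data Ne (n : ℕ) : Set where
    varL : Fin n → Ne n
    appL : Ne n → Apx n → Ne n

mutual
  data _≤ₐ_ {n : ℕ} : Apx n → Apx n → Set where
    Ω≤  : ∀ {a} → Ω ≤ₐ a
    nf≤ : ∀ {N N'} → N ≤N N' → nf N ≤ₐ nf N'

  data _≤N_ {n : ℕ} : Nf n → Nf n → Set where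
    ƛ≤   : ∀ {N N'} → N ≤N N' → ƛN N ≤N ƛN N'
    neu≤ : ∀ {L L'} → L ≤L L' → neu L ≤N neu L'

  data _≤L_ {n : ℕ} : Ne n → Ne n → Set where
    var≤ : ∀ {x} → varL x ≤L varL x
    app≤ : ∀ {L L' a a'} → L ≤L L' → a ≤ₐ a' → appL L a ≤L appL L' a'

-- a ≤ t : t is obtained from a by replacing each Ω by some term
mutual
  data _⊑_ {n : ℕ} : Apx n → Tm n → Set where
    Ω⊑  : ∀ {t} → Ω ⊑ t
    nf⊑ : ∀ {N t} → N ⊑N t → nf N ⊑ t

  data _⊑N_ {n : ℕ} : Nf n → Tm n → Set where
    ƛ⊑   : ∀ {N t} → N ⊑N t → ƛN N ⊑N ƛ t
    neu⊑ : ∀ {L t} → L ⊑L t → neu L ⊑N t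

  data _⊑L_ {n : ℕ} : Ne n → Tm n → Set where
    var⊑ : ∀ {x} → varL x ⊑L var x
    app⊑ : ∀ {L a t u} → L ⊑L t → a ⊑ u → appL L a ⊑L (t · u)

-- IsLub as b : b = ⋁ as (least upper bound w.r.t. ≤); in particular
-- ↑ as holds iff IsLub as b for some b; the lub of [] is Ω.
IsLub : ∀ {n} → List (Apx n) → Apx n → Set
IsLub {n} as b = All (_≤ₐ b) as × (∀ (c : Apx n) → All (_≤ₐ c) as → b ≤ₐ c)

-- Approximant of a derivation (relation: 𝒜(Π) ≡ a).  It is defined
-- when the subject is in Π-normal form.

mutual
  data ApxOf {n : ℕ} : ∀ {Γ t σ} → Γ ⊢ t ∶ σ → Nf n → Set where
    ax𝒜  : ∀ {x ρ} → ApxOf (ax {x = x} {ρ = ρ}) (neu (varL x))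
    →I𝒜  : ∀ {Γ A t τ} {Π : (A ∷ᵥ Γ) ⊢ t ∶ τ} {N} →
           ApxOf Π N → ApxOf (→I {Γ = Γ} Π) (ƛN N)
    →E𝒜  : ∀ {Γ Δ t u A B τ} {Π : Γ ⊢ t ∶ (A ⇒ τ)} {Πs : Δ ⊢ₘ u ∶ B} {e : A ≃ₘ B}
           {L a} → ApxOf Π (neu L) → ApxOfₘ Πs a → ApxOf (→E Π Πs e) (neu (appL L a))

  data ApxList {n : ℕ} : ∀ {Γ t A} → Γ ⊢ₘ t ∶ A → List (Nf n) → Set where
    []𝒜 : ∀ {t} → ApxList ([]ₘ {t = t}) []
    ∷𝒜  : ∀ {Δ Δs t σ A} {Π : Δ ⊢ t ∶ σ} {Πs : Δs ⊢ₘ t ∶ A} {N Ns} →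
          ApxOf Π N → ApxList Πs Ns → ApxList (Π ∷ₘ Πs) (N ∷ Ns)

  data ApxOfₘ {n : ℕ} : ∀ {Γ t A} → Γ ⊢ₘ t ∶ A → Apx n → Set where
    m𝒜 : ∀ {Γ t A} {Πs : Γ ⊢ₘ t ∶ A} {Ns b} →
         ApxList Πs Ns → IsLub (map nf Ns) b → ApxOfₘ Πs b

-- The inhabitation algorithm for H.
--   a ⊩T Γ , σ          :  a ⊩ T(Γ,σ)
--   a ⊩TI Γ , A         :  a ⊩ TI(Γ,A)
--   a ⊩H⟨ x ∶ ρ ⟩ Γ , τ  :  a ⊩ H^{x:[ρ]}(Γ,τ)
-- Where the paper equates environments / types (which are multiset
-- based) we use the multiset equalities ≈ₑ / ≃ₘ.

mutual
  data _⊩T_,_ : ∀ {n} → Nf n → Env n → Ty → Set where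
    Abs  : ∀ {n} {a : Nf (suc n)} {Γ : Env n} {A τ} →
           a ⊩T (A ∷ᵥ Γ) , τ → ƛN a ⊩T Γ , (A ⇒ τ)
    Head : ∀ {n} {a : Ne n} {x : Fin n} {ρ τ} {Γ Γ' : Env n} →
           τ ≼ ρ → a ⊩H⟨ x ∶ ρ ⟩ Γ , τ → Γ' ≈ₑ (Γ +ₑ (x ∶ₑ (ρ ∷ []))) →
           neu a ⊩T Γ' , τ

  data UnionPrem : ∀ {n} → List (Nf n) → Env n → MTy → Set where
    []U : ∀ {n} → UnionPrem {n} [] ∅ []
    ∷U  : ∀ {n} {a : Nf n} {as Γ Δ σ A} →
          a ⊩T Γ , σ → UnionPrem as Δ A → UnionPrem (a ∷ as) (Γ +ₑ Δ) (σ ∷ A)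

  data _⊩TI_,_ : ∀ {n} → Apx n → Env n → MTy → Set where
    Union : ∀ {n} {as : List (Nf n)} {Γ A b} →
            UnionPrem as Γ A → IsLub (map nf as) b → b ⊩TI Γ , A

  data _⊩H⟨_∶_⟩_,_ : ∀ {n} → Ne n → Fin n → Ty → Env n → Ty → Set where
    Head₀  : ∀ {n} {x : Fin n} {τ} → varL x ⊩H⟨ x ∶ τ ⟩ ∅ , τ
    Head>0 : ∀ {n} {x : Fin n} {ρ B B' τ} {Γ Γ₁ Γ₂ : Env n} {a b} →
             Γ ≈ₑ (Γ₁ +ₑ Γ₂) → (B ⇒ τ) ≼ ρ →
             a ⊩H⟨ x ∶ ρ ⟩ Γ₁ , (B ⇒ τ) → b ⊩TI Γ₂ , B' → B ≃ₘ B' →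
             appL a b ⊩H⟨ x ∶ ρ ⟩ Γ , τ

AlgT : ∀ {n} → Nf n → Env n → Ty → Set
AlgT {n} a Γ σ = Σ (Env n) λ Γ' → Σ Ty λ σ' → Γ ≈ₑ Γ' × σ ≃ σ' × (a ⊩T Γ' , σ')

{-# OPTIONS --safe #-}

-- Soundness: read each rule of the algorithm as the corresponding typing rule;
-- a term above the join ⋁ aᵢ of (Union) is above every aᵢ.
--
-- Completeness: H is quantitative.  Counting variable rules as size 0, the
-- substitution lemma replaces each variable occurrence by one premise of the
-- (m) derivation of the argument, so contracting a redex at a typed position
-- strictly decreases the size of the derivation.  Contracting typed redexes
-- therefore reaches a Π-normal derivation, and on a Π-normal derivation the
-- approximant is built along the algorithm: an abstraction is (Abs), an
-- application spine x a₁ … aₙ is (Head) over (Head>0)/(Head₀), and each (m)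
-- rule is a (Union), whose approximants all lie below the same term and hence
-- have a join.

module Submission where

open import Defs
open import Algebra.Bundles using (CommutativeMonoid)
open import Algebra.Structures using (IsCommutativeMonoid)
import Algebra.Properties.CommutativeMonoid.Sum as CommutativeMonoidSum
import Algebra.Properties.CommutativeSemigroup as CommutativeSemigroupProperties
open import Data.Empty using (⊥-elim)
open import Data.Fin using (Fin; zero; suc; punchIn)
open import Data.Fin.Properties using (punchInᵢ≢i)
open import Data.List using (List; []; _∷_; _++_; map)
open import Data.List.Relation.Binary.Permutation.Homogeneous using (refl; prep; swap; trans)
import Data.List.Relation.Binary.Permutation.Setoid.Properties as PermutationProperties
open import Data.List.Relation.Binary.Pointwise using (Pointwise; []; _∷_)
import Data.List.Relation.Binary.Pointwise.Properties as PointwiseProperties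
open import Data.List.Relation.Unary.All using (All; []; _∷_)
import Data.List.Relation.Unary.All as All
open import Data.Nat using (ℕ; zero; suc; _+_; _≤_; _<_; z≤n; s≤s)
open import Data.Nat.Induction using (<-wellFounded)
import Data.Nat.Properties as ℕ
open import Data.Product using (Σ; _×_; _,_)
open import Data.Sum using (_⊎_; inj₁; inj₂)
open import Data.Vec using (lookup; zipWith) renaming ([] to []ᵥ; _∷_ to _∷ᵥ_)
open import Data.Vec.Functional using () renaming (_∷_ to _∷ᶠ_)
open import Data.Vec.Properties using (lookup∘update; lookup∘update′; lookup-replicate; lookup-zipWith)
import Data.Vec.Relation.Binary.Pointwise.Inductive as Pointwiseᵥ
open import Function using (_∘_; case_of_)
open import Induction.WellFounded using (Acc; acc)
open import Level using (0ℓ)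
open import Relation.Binary.Bundles using (Setoid)
open import Relation.Binary.Construct.Closure.ReflexiveTransitive using (ε; _◅_)
open import Relation.Binary.PropositionalEquality using (_≡_; _≢_; cong; cong₂)
  renaming (refl to ≡-refl; sym to ≡-sym; trans to ≡-trans; subst to ≡-subst)
open import Relation.Binary.Structures using (IsEquivalence)
open import Relation.Nullary using (¬_)

mutual
  ≃-refl : ∀ {σ} → σ ≃ σ
  ≃-refl {base α} = base≃
  ≃-refl {A ⇒ σ}  = ⇒≃ ≃ₘ-refl ≃-refl

  ≃ₘ-refl : ∀ {A} → A ≃ₘ A
  ≃ₘ-refl = refl pointwise-refl

  private
    pointwise-refl : ∀ {A} → Pointwise _≃_ A A
    pointwise-refl {[]}    = []
    pointwise-refl {σ ∷ A} = ≃-refl ∷ pointwise-refl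

mutual
  ≃-sym : ∀ {σ τ} → σ ≃ τ → τ ≃ σ
  ≃-sym base≃    = base≃
  ≃-sym (⇒≃ p q) = ⇒≃ (≃ₘ-sym p) (≃-sym q)

  ≃ₘ-sym : ∀ {A B} → A ≃ₘ B → B ≃ₘ A
  ≃ₘ-sym (refl p)     = refl (pointwise-sym p)
  ≃ₘ-sym (prep e p)   = prep (≃-sym e) (≃ₘ-sym p)
  ≃ₘ-sym (swap e f p) = swap (≃-sym f) (≃-sym e) (≃ₘ-sym p)
  ≃ₘ-sym (trans p q)  = trans (≃ₘ-sym q) (≃ₘ-sym p)

  private
    pointwise-sym : ∀ {A B} → Pointwise _≃_ A B → Pointwise _≃_ B A
    pointwise-sym []      = []
    pointwise-sym (e ∷ p) = ≃-sym e ∷ pointwise-sym p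

≃-trans : ∀ {σ τ ρ} → σ ≃ τ → τ ≃ ρ → σ ≃ ρ
≃-trans base≃    base≃      = base≃
≃-trans (⇒≃ p q) (⇒≃ p' q') = ⇒≃ (trans p p') (≃-trans q q')

≃-isEquivalence : IsEquivalence _≃_
≃-isEquivalence = record { refl = ≃-refl ; sym = ≃-sym ; trans = ≃-trans }

Ty-setoid : Setoid 0ℓ 0ℓ
Ty-setoid = record { isEquivalence = ≃-isEquivalence }

open PermutationProperties Ty-setoid
  using (++-isCommutativeMonoid; ++⁺; All-resp-↭; xs↭ys⇒|xs|≡|ys|)

≃ₘ-[]-inv : ∀ {B} → [] ≃ₘ B → B ≡ []
≃ₘ-[]-inv {[]} _ = ≡-refl
≃ₘ-[]-inv {_ ∷ _} p with xs↭ys⇒|xs|≡|ys| p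
... | ()

≃ₘ-singleton-inv : ∀ {σ B} → (σ ∷ []) ≃ₘ B → Σ Ty λ τ → B ≡ τ ∷ [] × σ ≃ τ
≃ₘ-singleton-inv {σ} {B} p
  with B | xs↭ys⇒|xs|≡|ys| p | All-resp-↭ (λ x≃y σ≃x → ≃-trans σ≃x x≃y) p (≃-refl ∷ [])
... | τ ∷ [] | _ | σ≃τ ∷ [] = τ , ≡-refl , σ≃τ

module ++ₘ = IsCommutativeMonoid ++-isCommutativeMonoid

+ₑ-isCommutativeMonoid : ∀ n → IsCommutativeMonoid (_≈ₑ_ {n}) _+ₑ_ ∅
+ₑ-isCommutativeMonoid n = record
  { isMonoid = record
    { isSemigroup = record
      { isMagma = record
        { isEquivalence = Pointwiseᵥ.isEquivalence ++ₘ.isEquivalence n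
        ; ∙-cong        = Pointwiseᵥ.zipWith-cong ++⁺
        }
      ; assoc = Pointwiseᵥ.zipWith-assoc ++ₘ.assoc
      }
    ; identity = Pointwiseᵥ.zipWith-identityˡ ++ₘ.identityˡ
               , Pointwiseᵥ.zipWith-identityʳ ++ₘ.identityʳ
    }
  ; comm = Pointwiseᵥ.zipWith-comm ++ₘ.comm
  }

Env-commutativeMonoid : ℕ → CommutativeMonoid 0ℓ 0ℓ
Env-commutativeMonoid n = record { isCommutativeMonoid = +ₑ-isCommutativeMonoid n }

module Envₘ {n : ℕ} where
  open CommutativeMonoid (Env-commutativeMonoid n) public
    using (∙-cong; ∙-congˡ; ∙-congʳ; assoc; comm; identityˡ; identityʳ)
    renaming (refl to ≈ₑ-refl; sym to ≈ₑ-sym; trans to ≈ₑ-trans; reflexive to ≈ₑ-reflexive)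
  open CommutativeSemigroupProperties
         (CommutativeMonoid.commutativeSemigroup (Env-commutativeMonoid n)) public
    using (xy∙z≈xz∙y; x∙yz≈y∙xz)
  open CommutativeMonoidSum (Env-commutativeMonoid n) public
    using ()
    renaming ( sum to ∑ₑ; sum-cong-≋ to ∑ₑ-cong; ∑-distrib-+ to ∑ₑ-distrib-+ₑ
             ; sum-remove to ∑ₑ-remove; sum-replicate-zero to ∑ₑ-replicate-∅)

open Envₘ

∑ₑ-∅ : ∀ {m n} (F : Fin m → Env n) → (∀ i → F i ≈ₑ ∅) → ∑ₑ F ≈ₑ ∅
∑ₑ-∅ {m} F F≈∅ = ≈ₑ-trans (∑ₑ-cong F≈∅) (∑ₑ-replicate-∅ m)

∑ₑ-single : ∀ {m n} (F : Fin m → Env n) x → (∀ i → i ≢ x → F i ≈ₑ ∅) → ∑ₑ F ≈ₑ F x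
∑ₑ-single {suc m} F x F≈∅ = ≈ₑ-trans (∑ₑ-remove {i = x} F)
  (≈ₑ-trans (∙-congˡ (∑ₑ-∅ _ (λ j → F≈∅ (punchIn x j) (punchInᵢ≢i x j)))) (identityʳ (F x)))

∑ₑ-∷[] : ∀ {m n} (F : Fin m → Env n) → ∑ₑ (λ i → [] ∷ᵥ F i) ≡ [] ∷ᵥ ∑ₑ F
∑ₑ-∷[] {zero}  F = ≡-refl
∑ₑ-∷[] {suc m} F = cong (zipWith _++_ ([] ∷ᵥ F zero)) (∑ₑ-∷[] (F ∘ suc))

∶ₑ-[] : ∀ {n} (x : Fin n) → x ∶ₑ [] ≡ ∅
∶ₑ-[] {suc n} zero    = ≡-refl
∶ₑ-[] {suc n} (suc x) = cong ([] ∷ᵥ_) (∶ₑ-[] x)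

∶ₑ-++ : ∀ {n} (x : Fin n) A B → (x ∶ₑ (A ++ B)) ≈ₑ ((x ∶ₑ A) +ₑ (x ∶ₑ B))
∶ₑ-++ zero    A B = ≃ₘ-refl Pointwiseᵥ.∷ ≈ₑ-sym (identityˡ ∅)
∶ₑ-++ (suc x) A B = ≃ₘ-refl Pointwiseᵥ.∷ ∶ₑ-++ x A B

lookup-∶ₑ-≢ : ∀ {n} {x i : Fin n} A → i ≢ x → lookup (x ∶ₑ A) i ≡ []
lookup-∶ₑ-≢ {i = i} A i≢x = ≡-trans (lookup∘update′ i≢x ∅ A) (lookup-replicate i [])

renameEnv : ∀ {m n} → Ren m n → Env m → Env n
renameEnv ρ Γ = ∑ₑ (λ i → ρ i ∶ₑ lookup Γ i)

renameEnv-∅ : ∀ {m n} (ρ : Ren m n) → renameEnv ρ ∅ ≈ₑ ∅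
renameEnv-∅ ρ = ∑ₑ-∅ _ (λ i → ≈ₑ-reflexive (≡-trans (cong (ρ i ∶ₑ_) (lookup-replicate i [])) (∶ₑ-[] (ρ i))))

renameEnv-∶ₑ : ∀ {m n} (ρ : Ren m n) x A → renameEnv ρ (x ∶ₑ A) ≈ₑ (ρ x ∶ₑ A)
renameEnv-∶ₑ ρ x A = ≈ₑ-trans
  (∑ₑ-single _ x (λ i i≢x → ≈ₑ-reflexive (≡-trans (cong (ρ i ∶ₑ_) (lookup-∶ₑ-≢ A i≢x)) (∶ₑ-[] (ρ i)))))
  (≈ₑ-reflexive (cong (ρ x ∶ₑ_) (lookup∘update x ∅ A)))

renameEnv-+ₑ : ∀ {m n} (ρ : Ren m n) Γ Δ → renameEnv ρ (Γ +ₑ Δ) ≈ₑ (renameEnv ρ Γ +ₑ renameEnv ρ Δ)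
renameEnv-+ₑ ρ Γ Δ = ≈ₑ-trans
  (∑ₑ-cong λ i → ≈ₑ-trans (≈ₑ-reflexive (cong (ρ i ∶ₑ_) (lookup-zipWith _++_ i Γ Δ)))
                             (∶ₑ-++ (ρ i) (lookup Γ i) (lookup Δ i)))
  (∑ₑ-distrib-+ₑ (λ i → ρ i ∶ₑ lookup Γ i) (λ i → ρ i ∶ₑ lookup Δ i))

renameEnv-ext : ∀ {m n} (ρ : Ren m n) A Γ → renameEnv (ext ρ) (A ∷ᵥ Γ) ≈ₑ (A ∷ᵥ renameEnv ρ Γ)
renameEnv-ext ρ A Γ rewrite ∑ₑ-∷[] (λ i → ρ i ∶ₑ lookup Γ i) =
  ++ₘ.identityʳ A Pointwiseᵥ.∷ identityˡ _

renameEnv-id : ∀ {n} (Γ : Env n) → renameEnv (λ i → i) Γ ≈ₑ Γ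
renameEnv-id []ᵥ      = ≈ₑ-refl
renameEnv-id (A ∷ᵥ Γ) = ≈ₑ-trans (renameEnv-ext (λ i → i) A Γ) (≃ₘ-refl Pointwiseᵥ.∷ renameEnv-id Γ)

renameEnv-suc : ∀ {n} (Γ : Env n) → renameEnv suc Γ ≈ₑ ([] ∷ᵥ Γ)
renameEnv-suc Γ rewrite ∑ₑ-∷[] (λ i → i ∶ₑ lookup Γ i) = ≃ₘ-refl Pointwiseᵥ.∷ renameEnv-id Γ

-- Soundness

Typableₘ : ∀ {n} → Env n → Tm n → MTy → Set
Typableₘ Γ t A = Σ _ λ Γ' → Σ MTy λ A' → Γ ≈ₑ Γ' × A ≃ₘ A' × (Γ' ⊢ₘ t ∶ A')

Typable-resp : ∀ {n} {Γ Γ' : Env n} {t σ σ'} → Γ ≈ₑ Γ' → σ ≃ σ' → Typable Γ' t σ' → Typable Γ t σ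
Typable-resp Γ≈ σ≃ (_ , _ , Γ'≈ , σ'≃ , Π) = _ , _ , ≈ₑ-trans Γ≈ Γ'≈ , ≃-trans σ≃ σ'≃ , Π

mutual
  ≤ₐ-⊑-trans : ∀ {n} {a b : Apx n} {t} → a ≤ₐ b → b ⊑ t → a ⊑ t
  ≤ₐ-⊑-trans Ω≤      _       = Ω⊑
  ≤ₐ-⊑-trans (nf≤ p) (nf⊑ q) = nf⊑ (≤N-⊑N-trans p q)

  ≤N-⊑N-trans : ∀ {n} {a b : Nf n} {t} → a ≤N b → b ⊑N t → a ⊑N t
  ≤N-⊑N-trans (ƛ≤ p)   (ƛ⊑ q)   = ƛ⊑ (≤N-⊑N-trans p q)
  ≤N-⊑N-trans (neu≤ p) (neu⊑ q) = neu⊑ (≤L-⊑L-trans p q)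

  ≤L-⊑L-trans : ∀ {n} {a b : Ne n} {t} → a ≤L b → b ⊑L t → a ⊑L t
  ≤L-⊑L-trans var≤       var⊑       = var⊑
  ≤L-⊑L-trans (app≤ p q) (app⊑ r s) = app⊑ (≤L-⊑L-trans p r) (≤ₐ-⊑-trans q s)

All-≤ₐ-⊑ : ∀ {n} (as : List (Nf n)) {b t} → All (_≤ₐ b) (map nf as) → b ⊑ t → All (_⊑N t) as
All-≤ₐ-⊑ []       []       _   = []
All-≤ₐ-⊑ (a ∷ as) (p ∷ ps) b⊑t with ≤ₐ-⊑-trans p b⊑t
... | nf⊑ a⊑t = a⊑t ∷ All-≤ₐ-⊑ as ps b⊑t

mutual
  ⊩T-sound : ∀ {n} {a : Nf n} {Γ σ t} → a ⊩T Γ , σ → a ⊑N t → Typable Γ t σ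
  ⊩T-sound (Abs d) (ƛ⊑ p) with ⊩T-sound d p
  ... | _ , _ , A≃ Pointwiseᵥ.∷ Γ≈ , τ≃ , Π = _ , _ , Γ≈ , ⇒≃ A≃ τ≃ , →I Π
  ⊩T-sound (Head _ h Γ≈) (neu⊑ p) = Typable-resp Γ≈ ≃-refl (⊩H-sound h p)

  ⊩H-sound : ∀ {n} {a : Ne n} {x ρ Γ τ t} → a ⊩H⟨ x ∶ ρ ⟩ Γ , τ → a ⊑L t →
             Typable (Γ +ₑ (x ∶ₑ (ρ ∷ []))) t τ
  ⊩H-sound Head₀ var⊑ = _ , _ , identityˡ _ , ≃-refl , ax
  ⊩H-sound {x = x} {ρ} (Head>0 {Γ₁ = Γ₁} {Γ₂} Γ≈ _ h b B≃ₘ) (app⊑ p q)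
    with ⊩H-sound h p | ⊩TI-sound b q
  ... | _ , _ , Γ₁≈ , ⇒≃ B≃ τ≃ , Π | _ , _ , Γ₂≈ , B'≃ , Πs =
    _ , _ , ≈ₑ-trans (∙-congʳ Γ≈) (≈ₑ-trans (xy∙z≈xz∙y Γ₁ Γ₂ (x ∶ₑ (ρ ∷ []))) (∙-cong Γ₁≈ Γ₂≈)) ,
    τ≃ , →E Π Πs (trans (≃ₘ-sym B≃) (trans B≃ₘ B'≃))

  ⊩TI-sound : ∀ {n} {b : Apx n} {Γ A t} → b ⊩TI Γ , A → b ⊑ t → Typableₘ Γ t A
  ⊩TI-sound (Union {as = as} prem (upper , _)) b⊑t = UnionPrem-sound prem (All-≤ₐ-⊑ as upper b⊑t)

  UnionPrem-sound : ∀ {n} {as : List (Nf n)} {Γ A t} → UnionPrem as Γ A → All (_⊑N t) as → Typableₘ Γ t A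
  UnionPrem-sound []U         []       = ∅ , [] , ≈ₑ-refl , ≃ₘ-refl , []ₘ
  UnionPrem-sound (∷U d prem) (p ∷ ps) with ⊩T-sound d p | UnionPrem-sound prem ps
  ... | _ , _ , Γ≈ , σ≃ , Π | _ , _ , Δ≈ , A≃ , Πs = _ , _ , ∙-cong Γ≈ Δ≈ , prep σ≃ A≃ , Π ∷ₘ Πs

soundness : ∀ {n} {Γ : Env n} {σ a t} → AlgT a Γ σ → nf a ⊑ t → Typable Γ t σ
soundness (_ , _ , Γ≈ , σ≃ , d) (nf⊑ a⊑t) = Typable-resp Γ≈ σ≃ (⊩T-sound d a⊑t)

module ℕ+ = CommutativeSemigroupProperties ℕ.+-commutativeSemigroup

mutual
  size : ∀ {n} {Γ : Env n} {t σ} → Γ ⊢ t ∶ σ → ℕ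
  size ax          = 0
  size (→I Π)      = suc (size Π)
  size (→E Π Πs _) = suc (size Π + sizeₘ Πs)

  sizeₘ : ∀ {n} {Γ : Env n} {t A} → Γ ⊢ₘ t ∶ A → ℕ
  sizeₘ []ₘ        = 0
  sizeₘ (Π ∷ₘ Πs) = size Π + sizeₘ Πs

record BoundedTyping {n} (Γ : Env n) (t : Tm n) (σ : Ty) (k : ℕ) : Set where
  constructor bounded
  field
    {env}      : Env n
    {type}     : Ty
    env≈       : Γ ≈ₑ env
    type≃      : σ ≃ type
    derivation : env ⊢ t ∶ type
    size≤      : size derivation ≤ k

record BoundedTypingₘ {n} (Γ : Env n) (t : Tm n) (A : MTy) (k : ℕ) : Set where
  constructor boundedₘ
  field
    {env}      : Env n
    {type}     : MTy
    env≈       : Γ ≈ₑ env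
    type≃      : A ≃ₘ type
    derivation : env ⊢ₘ t ∶ type
    size≤      : sizeₘ derivation ≤ k

open BoundedTyping using (derivation)

BoundedTyping-resp : ∀ {n} {Γ Γ' : Env n} {t σ σ' k k'} →
                     Γ ≈ₑ Γ' → σ ≃ σ' → k ≤ k' → BoundedTyping Γ' t σ' k → BoundedTyping Γ t σ k'
BoundedTyping-resp Γ≈ σ≃ k≤ (bounded Γ'≈ σ'≃ Π s≤) =
  bounded (≈ₑ-trans Γ≈ Γ'≈) (≃-trans σ≃ σ'≃) Π (ℕ.≤-trans s≤ k≤)

BoundedTypingₘ-resp : ∀ {n} {Γ Γ' : Env n} {t A A' k k'} →
                      Γ ≈ₑ Γ' → A ≃ₘ A' → k ≤ k' → BoundedTypingₘ Γ' t A' k → BoundedTypingₘ Γ t A k'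
BoundedTypingₘ-resp Γ≈ A≃ k≤ (boundedₘ Γ'≈ A'≃ Πs s≤) =
  boundedₘ (≈ₑ-trans Γ≈ Γ'≈) (trans A≃ A'≃) Πs (ℕ.≤-trans s≤ k≤)

≤-+-interchange : ∀ {a b} c d p q {r} → a ≤ c + p → b ≤ d + q → p + q ≤ r → a + b ≤ (c + d) + r
≤-+-interchange {a} {b} c d p q {r} a≤ b≤ p+q≤ = begin
  a + b              ≤⟨ ℕ.+-mono-≤ a≤ b≤ ⟩
  (c + p) + (d + q)  ≡⟨ ℕ+.interchange c p d q ⟩
  (c + d) + (p + q)  ≤⟨ ℕ.+-monoʳ-≤ (c + d) p+q≤ ⟩
  (c + d) + r        ∎
  where open ℕ.≤-Reasoning

record Rearranged {n} {Δ : Env n} {u B} (Πs : Δ ⊢ₘ u ∶ B) (C : MTy) : Set where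
  constructor rearranged
  field
    {env}      : Env n
    {type}     : MTy
    env≈       : Δ ≈ₑ env
    type≋      : Pointwise _≃_ type C
    derivation : env ⊢ₘ u ∶ type
    size≡      : sizeₘ derivation ≡ sizeₘ Πs

≋-trans : ∀ {A B C} → Pointwise _≃_ A B → Pointwise _≃_ B C → Pointwise _≃_ A C
≋-trans = PointwiseProperties.transitive ≃-trans

-- Generalised to a pointwise-equal start so that the induction goes through `trans`.
⊢ₘ-rearrange : ∀ {n} {Δ : Env n} {u B B₀ C} (Πs : Δ ⊢ₘ u ∶ B) →
               Pointwise _≃_ B B₀ → B₀ ≃ₘ C → Rearranged Πs C
⊢ₘ-rearrange Πs B≋ (refl B₀≋) = rearranged ≈ₑ-refl (≋-trans B≋ B₀≋) Πs ≡-refl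
⊢ₘ-rearrange (Π ∷ₘ Πs) (σ≃ ∷ B≋) (prep σ≃' p) with ⊢ₘ-rearrange Πs B≋ p
... | rearranged Δ≈ C≋ Πs' s≡ =
  rearranged (∙-congˡ Δ≈) (≃-trans σ≃ σ≃' ∷ C≋) (Π ∷ₘ Πs') (cong (size Π +_) s≡)
⊢ₘ-rearrange (_∷ₘ_ {Δ = Δ₁} Π₁ (_∷ₘ_ {Δ = Δ₂} Π₂ Πs)) (σ₁≃ ∷ σ₂≃ ∷ B≋) (swap σ₁≃' σ₂≃' p)
  with ⊢ₘ-rearrange Πs B≋ p
... | rearranged {env = Δ'} Δ≈ C≋ Πs' s≡ =
  rearranged (≈ₑ-trans (∙-congˡ (∙-congˡ Δ≈)) (x∙yz≈y∙xz Δ₁ Δ₂ Δ'))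
             (≃-trans σ₂≃ σ₂≃' ∷ ≃-trans σ₁≃ σ₁≃' ∷ C≋) (Π₂ ∷ₘ (Π₁ ∷ₘ Πs'))
             (≡-trans (cong (λ k → size Π₂ + (size Π₁ + k)) s≡) (ℕ+.x∙yz≈y∙xz (size Π₂) (size Π₁) (sizeₘ Πs)))
⊢ₘ-rearrange Πs B≋ (trans p q) with ⊢ₘ-rearrange Πs B≋ p
... | rearranged Δ≈ C≋ Πs' s≡ with ⊢ₘ-rearrange Πs' C≋ q
... | rearranged Δ'≈ C'≋ Πs'' s'≡ = rearranged (≈ₑ-trans Δ≈ Δ'≈) C'≋ Πs'' (≡-trans s'≡ s≡)

record SplitTypingₘ {n} (Δ : Env n) (u : Tm n) (A₁ A₂ : MTy) (k : ℕ) : Set where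
  constructor split
  field
    {env₁ env₂}   : Env n
    {size₁ size₂} : ℕ
    part₁         : BoundedTypingₘ env₁ u A₁ size₁
    part₂         : BoundedTypingₘ env₂ u A₂ size₂
    env≈          : Δ ≈ₑ (env₁ +ₑ env₂)
    size≤         : size₁ + size₂ ≤ k

⊢ₘ-split : ∀ {n} {Δ : Env n} {u} C₁ {C₂} (Πs : Δ ⊢ₘ u ∶ (C₁ ++ C₂)) → SplitTypingₘ Δ u C₁ C₂ (sizeₘ Πs)
⊢ₘ-split []       Πs = split (boundedₘ ≈ₑ-refl ≃ₘ-refl []ₘ z≤n) (boundedₘ ≈ₑ-refl ≃ₘ-refl Πs ℕ.≤-refl)
                           (≈ₑ-sym (identityˡ _)) ℕ.≤-refl
⊢ₘ-split (σ ∷ C₁) (_∷ₘ_ {Δ = Δ₀} Π Πs) with ⊢ₘ-split C₁ Πs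
... | split {env₁ = Δ₁} {Δ₂} (boundedₘ Δ₁≈ C₁≃ Πs₁ s₁≤) part₂ Δ≈ s≤ =
  split (boundedₘ (∙-congˡ Δ₁≈) (prep ≃-refl C₁≃) (Π ∷ₘ Πs₁) (ℕ.+-monoʳ-≤ (size Π) s₁≤)) part₂
        (≈ₑ-trans (∙-congˡ Δ≈) (≈ₑ-sym (assoc Δ₀ Δ₁ Δ₂)))
        (ℕ.≤-trans (ℕ.≤-reflexive (ℕ.+-assoc (size Π) _ _)) (ℕ.+-monoʳ-≤ (size Π) s≤))

≋-++-split : ∀ A₁ {A₂ C} → Pointwise _≃_ C (A₁ ++ A₂) →
             Σ MTy λ C₁ → Σ MTy λ C₂ → C ≡ C₁ ++ C₂ × Pointwise _≃_ C₁ A₁ × Pointwise _≃_ C₂ A₂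
≋-++-split []       C≋               = [] , _ , ≡-refl , [] , C≋
≋-++-split (σ ∷ A₁) (σ'≃ ∷ C≋) with ≋-++-split A₁ C≋
... | C₁ , C₂ , ≡-refl , C₁≋ , C₂≋ = _ ∷ C₁ , C₂ , ≡-refl , σ'≃ ∷ C₁≋ , C₂≋

BoundedTypingₘ-split : ∀ {n} {Δ : Env n} {u} A₁ A₂ {k} →
                       BoundedTypingₘ Δ u (A₁ ++ A₂) k → SplitTypingₘ Δ u A₁ A₂ k
BoundedTypingₘ-split A₁ A₂ (boundedₘ Δ≈ A≃ Πs s≤)
  with ⊢ₘ-rearrange Πs (PointwiseProperties.refl ≃-refl) (≃ₘ-sym A≃)
... | rearranged Δ≈' C≋ Πs' s≡ with ≋-++-split A₁ C≋
... | C₁ , C₂ , ≡-refl , C₁≋ , C₂≋ with ⊢ₘ-split C₁ Πs'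
... | split part₁ part₂ Δ'≈ s'≤ =
  split (BoundedTypingₘ-resp ≈ₑ-refl (≋⇒≃ₘ C₁≋) ℕ.≤-refl part₁)
        (BoundedTypingₘ-resp ≈ₑ-refl (≋⇒≃ₘ C₂≋) ℕ.≤-refl part₂)
        (≈ₑ-trans Δ≈ (≈ₑ-trans Δ≈' Δ'≈))
        (ℕ.≤-trans s'≤ (ℕ.≤-trans (ℕ.≤-reflexive s≡) s≤))
  where
  ≋⇒≃ₘ : ∀ {A B} → Pointwise _≃_ A B → B ≃ₘ A
  ≋⇒≃ₘ A≋ = refl (PointwiseProperties.symmetric ≃-sym A≋)

retypeₘ : ∀ {n} {Δ : Env n} {u A A' k} → A ≡ A' → BoundedTypingₘ Δ u A k → BoundedTypingₘ Δ u A' k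
retypeₘ ≡-refl Πs = Πs

var-⊢ₘ : ∀ {n} (x : Fin n) A → BoundedTypingₘ (x ∶ₑ A) (var x) A 0
var-⊢ₘ x []      = boundedₘ (≈ₑ-reflexive (∶ₑ-[] x)) ≃ₘ-refl []ₘ z≤n
var-⊢ₘ x (σ ∷ A) with var-⊢ₘ x A
... | boundedₘ Δ≈ A≃ Πs s≤ =
  boundedₘ (≈ₑ-trans (∶ₑ-++ x (σ ∷ []) A) (∙-congˡ Δ≈)) (prep ≃-refl A≃) (ax ∷ₘ Πs) s≤

BoundedTypingₘ-[] : ∀ {n} {Δ : Env n} {u k} → BoundedTypingₘ Δ u [] k → Δ ≈ₑ ∅
BoundedTypingₘ-[] (boundedₘ Δ≈ A≃ Πs _) with ≃ₘ-[]-inv A≃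
BoundedTypingₘ-[] (boundedₘ Δ≈ A≃ []ₘ _) | ≡-refl = Δ≈

BoundedTypingₘ-singleton : ∀ {n} {Δ : Env n} {u σ k} → BoundedTypingₘ Δ u (σ ∷ []) k → BoundedTyping Δ u σ k
BoundedTypingₘ-singleton (boundedₘ Δ≈ A≃ Πs s≤) with ≃ₘ-singleton-inv A≃
BoundedTypingₘ-singleton (boundedₘ Δ≈ A≃ (Π ∷ₘ []ₘ) s≤) | _ , ≡-refl , σ≃ =
  bounded (≈ₑ-trans Δ≈ (identityʳ _)) σ≃ Π (ℕ.≤-trans (ℕ.≤-reflexive (≡-sym (ℕ.+-identityʳ (size Π)))) s≤)

-- Renaming and substitution

mutual
  rename-⊢ : ∀ {m n} (ρ : Ren m n) {Γ : Env m} {t τ} (Π : Γ ⊢ t ∶ τ) →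
             BoundedTyping (renameEnv ρ Γ) (rename ρ t) τ (size Π)
  rename-⊢ ρ (ax {x = x} {ρ = τ}) = bounded (renameEnv-∶ₑ ρ x (τ ∷ [])) ≃-refl ax z≤n
  rename-⊢ ρ (→I {Γ = Γ} {A = A} Π) with rename-⊢ (ext ρ) Π
  ... | bounded Γ≈ τ≃ Π' s≤ with ≈ₑ-trans (≈ₑ-sym (renameEnv-ext ρ A Γ)) Γ≈
  ... | A≃ Pointwiseᵥ.∷ Γ≈' = bounded Γ≈' (⇒≃ A≃ τ≃) (→I Π') (s≤s s≤)
  rename-⊢ ρ (→E {Γ = Γ} {Δ = Δ} Π Πs A≃B) with rename-⊢ ρ Π | rename-⊢ₘ ρ Πs
  ... | bounded Γ≈ (⇒≃ A≃ τ≃) Π' s≤ | boundedₘ Δ≈ B≃ Πs' sₘ≤ =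
    bounded (≈ₑ-trans (renameEnv-+ₑ ρ Γ Δ) (∙-cong Γ≈ Δ≈)) τ≃
            (→E Π' Πs' (trans (≃ₘ-sym A≃) (trans A≃B B≃))) (s≤s (ℕ.+-mono-≤ s≤ sₘ≤))

  rename-⊢ₘ : ∀ {m n} (ρ : Ren m n) {Γ : Env m} {t A} (Πs : Γ ⊢ₘ t ∶ A) →
              BoundedTypingₘ (renameEnv ρ Γ) (rename ρ t) A (sizeₘ Πs)
  rename-⊢ₘ ρ []ₘ = boundedₘ (renameEnv-∅ ρ) ≃ₘ-refl []ₘ z≤n
  rename-⊢ₘ ρ (_∷ₘ_ {Δ = Δ₁} {Δs = Δ₂} Π Πs) with rename-⊢ ρ Π | rename-⊢ₘ ρ Πs
  ... | bounded Δ₁≈ σ≃ Π' s≤ | boundedₘ Δ₂≈ A≃ Πs' sₘ≤ =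
    boundedₘ (≈ₑ-trans (renameEnv-+ₑ ρ Δ₁ Δ₂) (∙-cong Δ₁≈ Δ₂≈)) (prep σ≃ A≃) (Π' ∷ₘ Πs') (ℕ.+-mono-≤ s≤ sₘ≤)

open CommutativeMonoidSum ℕ.+-0-commutativeMonoid using (∑-distrib-+)
  renaming (sum to ∑; sum-remove to ∑-remove; sum-replicate-zero to ∑-replicate-0)

∑-mono-≤ : ∀ {m} {k l : Fin m → ℕ} → (∀ i → k i ≤ l i) → ∑ k ≤ ∑ l
∑-mono-≤ {zero}  k≤l = z≤n
∑-mono-≤ {suc m} k≤l = ℕ.+-mono-≤ (k≤l zero) (∑-mono-≤ (k≤l ∘ suc))

≤-∑ : ∀ {m} (k : Fin m → ℕ) x → k x ≤ ∑ k
≤-∑ {suc m} k x = ℕ.≤-trans (ℕ.m≤m+n (k x) _) (ℕ.≤-reflexive (≡-sym (∑-remove {i = x} k)))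

SubTyping : ∀ {m n} → (Fin m → Env n) → Sub m n → Env m → (Fin m → ℕ) → Set
SubTyping Δ σ Γ k = ∀ i → BoundedTypingₘ (Δ i) (σ i) (lookup Γ i) (k i)

record SplitSubTyping {m n} (Δ : Fin m → Env n) (σ : Sub m n) (Γ₁ Γ₂ : Env m) (k : Fin m → ℕ) : Set where
  constructor splitSub
  field
    {Δ₁ Δ₂} : Fin m → Env n
    {k₁ k₂} : Fin m → ℕ
    typing₁ : SubTyping Δ₁ σ Γ₁ k₁
    typing₂ : SubTyping Δ₂ σ Γ₂ k₂
    env≈    : ∑ₑ Δ ≈ₑ (∑ₑ Δ₁ +ₑ ∑ₑ Δ₂)
    size≤   : ∑ k₁ + ∑ k₂ ≤ ∑ k

SubTyping-split : ∀ {m n} {Δ : Fin m → Env n} {σ} Γ₁ Γ₂ {k} →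
                  SubTyping Δ σ (Γ₁ +ₑ Γ₂) k → SplitSubTyping Δ σ Γ₁ Γ₂ k
SubTyping-split Γ₁ Γ₂ F = splitSub (part₁ ∘ parts) (part₂ ∘ parts)
  (≈ₑ-trans (∑ₑ-cong (env≈ ∘ parts)) (∑ₑ-distrib-+ₑ (env₁ ∘ parts) (env₂ ∘ parts)))
  (ℕ.≤-trans (ℕ.≤-reflexive (≡-sym (∑-distrib-+ (size₁ ∘ parts) (size₂ ∘ parts)))) (∑-mono-≤ (size≤ ∘ parts)))
  where
  open SplitTypingₘ
  parts : ∀ i → SplitTypingₘ _ _ (lookup Γ₁ i) (lookup Γ₂ i) _
  parts i = BoundedTypingₘ-split (lookup Γ₁ i) (lookup Γ₂ i)
              (retypeₘ (lookup-zipWith _++_ i Γ₁ Γ₂) (F i))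

SubTyping-exts : ∀ {m n} {Δ : Fin m → Env n} {σ Γ k} A → SubTyping Δ σ Γ k →
                 SubTyping ((A ∷ᵥ ∅) ∷ᶠ λ i → [] ∷ᵥ Δ i) (exts σ) (A ∷ᵥ Γ) (0 ∷ᶠ k)
SubTyping-exts A F zero    = var-⊢ₘ zero A
SubTyping-exts A F (suc i) with F i
... | boundedₘ {env = E} Δ≈ A≃ Πs s≤ =
  BoundedTypingₘ-resp (≈ₑ-trans (≃ₘ-refl Pointwiseᵥ.∷ Δ≈) (≈ₑ-sym (renameEnv-suc E))) A≃ s≤ (rename-⊢ₘ suc Πs)

∑ₑ-exts : ∀ {m n} A (Δ : Fin m → Env n) → ∑ₑ ((A ∷ᵥ ∅) ∷ᶠ λ i → [] ∷ᵥ Δ i) ≈ₑ (A ∷ᵥ ∑ₑ Δ)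
∑ₑ-exts A Δ rewrite ∑ₑ-∷[] Δ = ++ₘ.identityʳ A Pointwiseᵥ.∷ identityˡ (∑ₑ Δ)

mutual
  subst-⊢ : ∀ {m n} {Γ : Env m} {s τ} (Π : Γ ⊢ s ∶ τ) {σ : Sub m n} {Δ k} →
            SubTyping Δ σ Γ k → BoundedTyping (∑ₑ Δ) (subst σ s) τ (size Π + ∑ k)
  subst-⊢ (ax {x = x} {ρ = ρ}) {Δ = Δ} {k} F =
    BoundedTyping-resp (∑ₑ-single Δ x others-empty) ≃-refl (≤-∑ k x)
      (BoundedTypingₘ-singleton (retypeₘ (lookup∘update x ∅ (ρ ∷ [])) (F x)))
    where
    others-empty : ∀ i → i ≢ x → Δ i ≈ₑ ∅
    others-empty i i≢x = BoundedTypingₘ-[] (retypeₘ (lookup-∶ₑ-≢ (ρ ∷ []) i≢x) (F i))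
  subst-⊢ (→I {A = A} Π) {Δ = Δ} F with subst-⊢ Π (SubTyping-exts A F)
  ... | bounded Γ≈ τ≃ Π' s≤ with ≈ₑ-trans (≈ₑ-sym (∑ₑ-exts A Δ)) Γ≈
  ... | A≃ Pointwiseᵥ.∷ Γ≈' = bounded Γ≈' (⇒≃ A≃ τ≃) (→I Π') (s≤s s≤)
  subst-⊢ (→E {Γ = Γ₁} {Δ = Γ₂} Π Πs A≃B) F with SubTyping-split Γ₁ Γ₂ F
  ... | splitSub {k₁ = k₁} {k₂} F₁ F₂ Δ≈ k≤ with subst-⊢ Π F₁ | subst-⊢ₘ Πs F₂
  ... | bounded Γ₁≈ (⇒≃ A≃ τ≃) Π' s≤ | boundedₘ Γ₂≈ B≃ Πs' sₘ≤ =
    bounded (≈ₑ-trans Δ≈ (∙-cong Γ₁≈ Γ₂≈)) τ≃ (→E Π' Πs' (trans (≃ₘ-sym A≃) (trans A≃B B≃)))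
            (s≤s (≤-+-interchange (size Π) (sizeₘ Πs) (∑ k₁) (∑ k₂) s≤ sₘ≤ k≤))

  subst-⊢ₘ : ∀ {m n} {Γ : Env m} {s A} (Πs : Γ ⊢ₘ s ∶ A) {σ : Sub m n} {Δ k} →
             SubTyping Δ σ Γ k → BoundedTypingₘ (∑ₑ Δ) (subst σ s) A (sizeₘ Πs + ∑ k)
  subst-⊢ₘ []ₘ {Δ = Δ} F =
    boundedₘ (∑ₑ-∅ Δ (λ i → BoundedTypingₘ-[] (retypeₘ (lookup-replicate i []) (F i)))) ≃ₘ-refl []ₘ z≤n
  subst-⊢ₘ (_∷ₘ_ {Δ = Γ₁} {Δs = Γ₂} Π Πs) F with SubTyping-split Γ₁ Γ₂ F
  ... | splitSub {k₁ = k₁} {k₂} F₁ F₂ Δ≈ k≤ with subst-⊢ Π F₁ | subst-⊢ₘ Πs F₂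
  ... | bounded Γ₁≈ σ≃ Π' s≤ | boundedₘ Γ₂≈ A≃ Πs' sₘ≤ =
    boundedₘ (≈ₑ-trans Δ≈ (∙-cong Γ₁≈ Γ₂≈)) (prep σ≃ A≃) (Π' ∷ₘ Πs')
             (≤-+-interchange (size Π) (sizeₘ Πs) (∑ k₁) (∑ k₂) s≤ sₘ≤ k≤)

subst-cong : ∀ {m n} {σ σ' : Sub m n} → (∀ i → σ i ≡ σ' i) → ∀ s → subst σ s ≡ subst σ' s
subst-cong σ≗σ' (var x) = σ≗σ' x
subst-cong σ≗σ' (ƛ s)   = cong ƛ (subst-cong exts-cong s)
  where
  exts-cong : ∀ i → exts _ i ≡ exts _ i
  exts-cong zero    = ≡-refl
  exts-cong (suc i) = cong (rename suc) (σ≗σ' i)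
subst-cong σ≗σ' (s · t) = cong₂ _·_ (subst-cong σ≗σ' s) (subst-cong σ≗σ' t)

β-⊢ : ∀ {n} {Γ Δ : Env n} {A B s u τ} (Π : (A ∷ᵥ Γ) ⊢ s ∶ τ) (Πs : Δ ⊢ₘ u ∶ B) → A ≃ₘ B →
      BoundedTyping (Γ +ₑ Δ) (s [ u ]) τ (size Π + sizeₘ Πs)
β-⊢ {n} {Γ} {Δ} {A} {s = s} {u} {τ} Π Πs A≃B =
  ≡-subst (λ t → BoundedTyping (Γ +ₑ Δ) t τ (size Π + sizeₘ Πs))
          (subst-cong (λ { zero → ≡-refl ; (suc i) → ≡-refl }) s)
    (BoundedTyping-resp (≈ₑ-trans (comm Γ Δ) (∙-congˡ (≈ₑ-sym (renameEnv-id Γ)))) ≃-refl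
      (ℕ.≤-reflexive (cong (size Π +_) (≡-trans (cong (sizeₘ Πs +_) (∑-replicate-0 n)) (ℕ.+-identityʳ _))))
      (subst-⊢ Π Fβ))
  where
  σβ : Sub _ _
  σβ = u ∷ᶠ var
  Fβ : SubTyping (Δ ∷ᶠ λ i → i ∶ₑ lookup Γ i) σβ (A ∷ᵥ Γ) (sizeₘ Πs ∷ᶠ λ _ → 0)
  Fβ zero    = boundedₘ ≈ₑ-refl A≃B Πs ℕ.≤-refl
  Fβ (suc i) = var-⊢ₘ i (lookup Γ i)

-- Subject reduction and normalisation

plug-β : ∀ {n m} (C : Ctx n m) {s v} → plug C (ƛ s · v) →β plug C (s [ v ])
plug-β □        = β
plug-β (ƛC C)   = ξƛ (plug-β C)
plug-β (C ·ₗ w) = ξ·ₗ (plug-β C)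
plug-β (w ·ᵣ C) = ξ·ᵣ (plug-β C)

-- A redex at an untyped position lies in an argument typed by the empty
-- multiset, so only reduction at typed positions shrinks the derivation.
mutual
  subject-reduction : ∀ {n m} (C : Ctx n m) {s v} {Γ : Env n} {σ} (Π : Γ ⊢ plug C (ƛ s · v) ∶ σ) →
                      Σ (BoundedTyping Γ (plug C (s [ v ])) σ (size Π)) λ r →
                        TOcc Π C → size (derivation r) < size Π
  subject-reduction □ (→E (→I Π₁) Πs A≃B) with β-⊢ Π₁ Πs A≃B
  ... | bounded Γ≈ τ≃ Π' s≤ = bounded Γ≈ τ≃ Π' (ℕ.<⇒≤ s<) , λ _ → s<
    where s< = ℕ.≤-<-trans s≤ (s≤s (ℕ.n≤1+n _))
  subject-reduction (ƛC C) (→I Π) with subject-reduction C Π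
  ... | bounded (A≃ Pointwiseᵥ.∷ Γ≈) τ≃ Π' s≤ , s< =
    bounded Γ≈ (⇒≃ A≃ τ≃) (→I Π') (s≤s s≤) , λ { (inƛ o) → s≤s (s< o) }
  subject-reduction (C ·ₗ w) (→E Π Πs A≃B) with subject-reduction C Π
  ... | bounded Γ≈ (⇒≃ A≃ τ≃) Π' s≤ , s< =
    bounded (∙-congʳ Γ≈) τ≃ (→E Π' Πs (trans (≃ₘ-sym A≃) A≃B)) (s≤s (ℕ.+-monoˡ-≤ (sizeₘ Πs) s≤)) ,
    λ { (inFun o) → s≤s (ℕ.+-monoˡ-< (sizeₘ Πs) (s< o)) }
  subject-reduction (w ·ᵣ C) (→E Π Πs A≃B) with subject-reductionₘ C Πs
  ... | boundedₘ Δ≈ B≃ Πs' s≤ , s< =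
    bounded (∙-congˡ Δ≈) ≃-refl (→E Π Πs' (trans A≃B B≃)) (s≤s (ℕ.+-monoʳ-≤ (size Π) s≤)) ,
    λ { (inArg o) → s≤s (ℕ.+-monoʳ-< (size Π) (s< o)) }

  subject-reductionₘ : ∀ {n m} (C : Ctx n m) {s v} {Δ : Env n} {B} (Πs : Δ ⊢ₘ plug C (ƛ s · v) ∶ B) →
                       Σ (BoundedTypingₘ Δ (plug C (s [ v ])) B (sizeₘ Πs)) λ r →
                         TOccₘ Πs C → sizeₘ (BoundedTypingₘ.derivation r) < sizeₘ Πs
  subject-reductionₘ C []ₘ = boundedₘ ≈ₑ-refl ≃ₘ-refl []ₘ z≤n , λ ()
  subject-reductionₘ C (Π ∷ₘ Πs) with subject-reduction C Π | subject-reductionₘ C Πs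
  ... | bounded Γ≈ σ≃ Π' s≤ , s< | boundedₘ Δ≈ A≃ Πs' sₘ≤ , sₘ< =
    boundedₘ (∙-cong Γ≈ Δ≈) (prep σ≃ A≃) (Π' ∷ₘ Πs') (ℕ.+-mono-≤ s≤ sₘ≤) ,
    λ { (inHd o) → ℕ.+-mono-<-≤ (s< o) sₘ≤ ; (inTl o) → ℕ.+-mono-≤-< s≤ (sₘ< o) }

ΠNormalₘ : ∀ {n} {Γ : Env n} {t A} → Γ ⊢ₘ t ∶ A → Set
ΠNormalₘ {n} {t = t} Πs = ∀ {m} (C : Ctx n m) (u : Tm m) → TOccₘ Πs C → plug C u ≡ t → ¬ IsRedex u

NotAbs : ∀ {n} → Tm n → Set
NotAbs t = ¬ Σ _ λ s → t ≡ ƛ s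

ax-normal : ∀ {n} {x : Fin n} {ρ} → ΠNormal (ax {x = x} {ρ = ρ})
ax-normal □ _ here ≡-refl (_ , _ , ())

→I-normal : ∀ {n} {Γ : Env n} {A t τ} {Π : (A ∷ᵥ Γ) ⊢ t ∶ τ} → ΠNormal Π → ΠNormal (→I {Γ = Γ} Π)
→I-normal N □      _ here     ≡-refl (_ , _ , ())
→I-normal N (ƛC C) u (inƛ o) ≡-refl = N C u o ≡-refl

→E-normal : ∀ {n} {Γ Δ : Env n} {t u A B τ} {Π : Γ ⊢ t ∶ (A ⇒ τ)} {Πs : Δ ⊢ₘ u ∶ B} {A≃B : A ≃ₘ B} →
            NotAbs t → ΠNormal Π → ΠNormalₘ Πs → ΠNormal (→E Π Πs A≃B)
→E-normal ¬abs N Nₘ □        _ here        ≡-refl (s , _ , ≡-refl) = ¬abs (s , ≡-refl)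
→E-normal ¬abs N Nₘ (C ·ₗ w) u (inFun o) ≡-refl = N C u o ≡-refl
→E-normal ¬abs N Nₘ (w ·ᵣ C) u (inArg o) ≡-refl = Nₘ C u o ≡-refl

→I-normal⁻ : ∀ {n} {Γ : Env n} {A t τ} {Π : (A ∷ᵥ Γ) ⊢ t ∶ τ} → ΠNormal (→I {Γ = Γ} Π) → ΠNormal Π
→I-normal⁻ N C u o eq = N (ƛC C) u (inƛ o) (cong ƛ eq)

module _ {n} {Γ Δ : Env n} {t u A B τ} {Π : Γ ⊢ t ∶ (A ⇒ τ)} {Πs : Δ ⊢ₘ u ∶ B} {A≃B : A ≃ₘ B}
         (N : ΠNormal (→E Π Πs A≃B)) where

  →E-normal⁻-notAbs : NotAbs t
  →E-normal⁻-notAbs (s , ≡-refl) = N □ (t · u) here ≡-refl (s , u , ≡-refl)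

  →E-normal⁻-fun : ΠNormal Π
  →E-normal⁻-fun C w o eq = N (C ·ₗ u) w (inFun o) (cong (_· u) eq)

  →E-normal⁻-arg : ΠNormalₘ Πs
  →E-normal⁻-arg C w o eq = N (t ·ᵣ C) w (inArg o) (cong (t ·_) eq)

module _ {n} {Δ Δs : Env n} {t σ A} {Π : Δ ⊢ t ∶ σ} {Πs : Δs ⊢ₘ t ∶ A} (N : ΠNormalₘ (Π ∷ₘ Πs)) where

  ∷ₘ-normal⁻-head : ΠNormal Π
  ∷ₘ-normal⁻-head C u o = N C u (inHd o)

  ∷ₘ-normal⁻-tail : ΠNormalₘ Πs
  ∷ₘ-normal⁻-tail C u o = N C u (inTl o)

data TypedRedex {n} {Γ : Env n} {t σ} (Π : Γ ⊢ t ∶ σ) : Set where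
  typedRedex : ∀ {m} (C : Ctx n m) s v → TOcc Π C → plug C (ƛ s · v) ≡ t → TypedRedex Π

data TypedRedexₘ {n} {Γ : Env n} {t A} (Πs : Γ ⊢ₘ t ∶ A) : Set where
  typedRedexₘ : ∀ {m} (C : Ctx n m) s v → TOccₘ Πs C → plug C (ƛ s · v) ≡ t → TypedRedexₘ Πs

mutual
  normal-or-redex : ∀ {n} {Γ : Env n} {t σ} (Π : Γ ⊢ t ∶ σ) → ΠNormal Π ⊎ TypedRedex Π
  normal-or-redex ax = inj₁ ax-normal
  normal-or-redex (→I Π) with normal-or-redex Π
  ... | inj₁ N                       = inj₁ (→I-normal N)
  ... | inj₂ (typedRedex C s v o eq) = inj₂ (typedRedex (ƛC C) s v (inƛ o) (cong ƛ eq))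
  normal-or-redex (→E {t = ƛ s}   Π Πs _) = inj₂ (typedRedex □ s _ here ≡-refl)
  normal-or-redex (→E {t = var _} Π Πs _) = →E-normal-or-redex (λ ()) Π Πs
  normal-or-redex (→E {t = _ · _} Π Πs _) = →E-normal-or-redex (λ ()) Π Πs

  →E-normal-or-redex : ∀ {n} {Γ Δ : Env n} {t u A B τ} {A≃B : A ≃ₘ B} → NotAbs t →
                       (Π : Γ ⊢ t ∶ (A ⇒ τ)) (Πs : Δ ⊢ₘ u ∶ B) →
                       ΠNormal (→E Π Πs A≃B) ⊎ TypedRedex (→E Π Πs A≃B)
  →E-normal-or-redex {u = u} ¬abs Π Πs with normal-or-redex Π | normal-or-redexₘ Πs
  ... | inj₂ (typedRedex C s v o eq) | _ = inj₂ (typedRedex (C ·ₗ u) s v (inFun o) (cong (_· u) eq))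
  ... | inj₁ _ | inj₂ (typedRedexₘ C s v o eq) = inj₂ (typedRedex (_ ·ᵣ C) s v (inArg o) (cong (_ ·_) eq))
  ... | inj₁ N | inj₁ Nₘ = inj₁ (→E-normal ¬abs N Nₘ)

  normal-or-redexₘ : ∀ {n} {Γ : Env n} {t A} (Πs : Γ ⊢ₘ t ∶ A) → ΠNormalₘ Πs ⊎ TypedRedexₘ Πs
  normal-or-redexₘ []ₘ = inj₁ λ _ _ ()
  normal-or-redexₘ (Π ∷ₘ Πs) with normal-or-redex Π | normal-or-redexₘ Πs
  ... | inj₂ (typedRedex C s v o eq) | _ = inj₂ (typedRedexₘ C s v (inHd o) eq)
  ... | inj₁ _ | inj₂ (typedRedexₘ C s v o eq) = inj₂ (typedRedexₘ C s v (inTl o) eq)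
  ... | inj₁ N | inj₁ Nₘ = inj₁ λ { C u (inHd o) → N C u o ; C u (inTl o) → Nₘ C u o }

record NormalTyping {n} (Γ : Env n) (t : Tm n) (σ : Ty) : Set where
  constructor normalTyping
  field
    {reduct}   : Tm n
    reduces    : t →β* reduct
    {env}      : Env n
    {type}     : Ty
    env≈       : Γ ≈ₑ env
    type≃      : σ ≃ type
    derivation : env ⊢ reduct ∶ type
    normal     : ΠNormal derivation

normalise : ∀ {n} {Γ : Env n} {t σ} (Π : Γ ⊢ t ∶ σ) → Acc _<_ (size Π) → NormalTyping Γ t σ
normalise Π (acc smaller) with normal-or-redex Π
... | inj₁ N = normalTyping ε ≈ₑ-refl ≃-refl Π N
... | inj₂ (typedRedex C s v o ≡-refl) with subject-reduction C Π
... | bounded Γ≈ σ≃ Π' _ , s< with normalise Π' (smaller (s< o))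
... | normalTyping t'→* Γ'≈ σ'≃ Π'' N =
  normalTyping (plug-β C ◅ t'→*) (≈ₑ-trans Γ≈ Γ'≈) (≃-trans σ≃ σ'≃) Π'' N

-- Approximants

mutual
  ≤ₐ-refl : ∀ {n} {a : Apx n} → a ≤ₐ a
  ≤ₐ-refl {a = Ω}    = Ω≤
  ≤ₐ-refl {a = nf N} = nf≤ ≤N-refl

  ≤N-refl : ∀ {n} {N : Nf n} → N ≤N N
  ≤N-refl {N = ƛN N}  = ƛ≤ ≤N-refl
  ≤N-refl {N = neu L} = neu≤ ≤L-refl

  ≤L-refl : ∀ {n} {L : Ne n} → L ≤L L
  ≤L-refl {L = varL x}   = var≤
  ≤L-refl {L = appL L a} = app≤ ≤L-refl ≤ₐ-refl

mutual
  ≤ₐ-trans : ∀ {n} {a b c : Apx n} → a ≤ₐ b → b ≤ₐ c → a ≤ₐ c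
  ≤ₐ-trans Ω≤      _       = Ω≤
  ≤ₐ-trans (nf≤ p) (nf≤ q) = nf≤ (≤N-trans p q)

  ≤N-trans : ∀ {n} {a b c : Nf n} → a ≤N b → b ≤N c → a ≤N c
  ≤N-trans (ƛ≤ p)   (ƛ≤ q)   = ƛ≤ (≤N-trans p q)
  ≤N-trans (neu≤ p) (neu≤ q) = neu≤ (≤L-trans p q)

  ≤L-trans : ∀ {n} {a b c : Ne n} → a ≤L b → b ≤L c → a ≤L c
  ≤L-trans var≤         var≤         = var≤
  ≤L-trans (app≤ p p') (app≤ q q') = app≤ (≤L-trans p q) (≤ₐ-trans p' q')

record Join {A : Set} (_≤_ : A → A → Set) (Below : A → Set) (a b : A) : Set where
  constructor join
  field
    ⋁      : A
    upperˡ : a ≤ ⋁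
    upperʳ : b ≤ ⋁
    below  : Below ⋁
    least  : ∀ c → a ≤ c → b ≤ c → ⋁ ≤ c

mutual
  ⊑-join : ∀ {n} {t : Tm n} {a b} → a ⊑ t → b ⊑ t → Join _≤ₐ_ (_⊑ t) a b
  ⊑-join Ω⊑      b⊑ = join _ Ω≤ ≤ₐ-refl b⊑ λ _ _ b≤ → b≤
  ⊑-join (nf⊑ p) Ω⊑ = join _ ≤ₐ-refl Ω≤ (nf⊑ p) λ _ a≤ _ → a≤
  ⊑-join (nf⊑ p) (nf⊑ q) with ⊑N-join p q
  ... | join N a≤ b≤ N⊑ least =
    join (nf N) (nf≤ a≤) (nf≤ b≤) (nf⊑ N⊑) λ { (nf M) (nf≤ a≤M) (nf≤ b≤M) → nf≤ (least M a≤M b≤M) }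

  ⊑N-join : ∀ {n} {t : Tm n} {a b} → a ⊑N t → b ⊑N t → Join _≤N_ (_⊑N t) a b
  ⊑N-join (ƛ⊑ p) (ƛ⊑ q) with ⊑N-join p q
  ... | join N a≤ b≤ N⊑ least =
    join (ƛN N) (ƛ≤ a≤) (ƛ≤ b≤) (ƛ⊑ N⊑) λ { (ƛN M) (ƛ≤ a≤M) (ƛ≤ b≤M) → ƛ≤ (least M a≤M b≤M) }
  ⊑N-join (ƛ⊑ p)   (neu⊑ ())
  ⊑N-join (neu⊑ ()) (ƛ⊑ q)
  ⊑N-join (neu⊑ p) (neu⊑ q) with ⊑L-join p q
  ... | join L a≤ b≤ L⊑ least =
    join (neu L) (neu≤ a≤) (neu≤ b≤) (neu⊑ L⊑) λ { (neu M) (neu≤ a≤M) (neu≤ b≤M) → neu≤ (least M a≤M b≤M) }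

  ⊑L-join : ∀ {n} {t : Tm n} {a b} → a ⊑L t → b ⊑L t → Join _≤L_ (_⊑L t) a b
  ⊑L-join var⊑ var⊑ = join _ var≤ var≤ var⊑ λ _ a≤ _ → a≤
  ⊑L-join (app⊑ p p') (app⊑ q q') with ⊑L-join p q | ⊑-join p' q'
  ... | join L a≤ b≤ L⊑ least | join c a'≤ b'≤ c⊑ least' =
    join (appL L c) (app≤ a≤ a'≤) (app≤ b≤ b'≤) (app⊑ L⊑ c⊑)
      λ { (appL M d) (app≤ a≤M a'≤d) (app≤ b≤M b'≤d) → app≤ (least M a≤M b≤M) (least' d a'≤d b'≤d) }

⊑-lub : ∀ {n} {t : Tm n} (as : List (Nf n)) → All (_⊑N t) as → Σ (Apx n) λ b → IsLub (map nf as) b × b ⊑ t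
⊑-lub []       []       = Ω , ([] , λ _ _ → Ω≤) , Ω⊑
⊑-lub (a ∷ as) (p ∷ ps) with ⊑-lub as ps
... | b , (upper , least) , b⊑ with ⊑-join (nf⊑ p) b⊑
... | join c a≤ b≤ c⊑ least' =
  c , (a≤ ∷ All.map (λ a'≤b → ≤ₐ-trans a'≤b b≤) upper , λ { d (a≤d ∷ as≤d) → least' d a≤d (least d as≤d) }) ,
  c⊑

≼-⇒ : ∀ {A τ ρ} → (A ⇒ τ) ≼ ρ → τ ≼ ρ
≼-⇒ here      = there here
≼-⇒ (there p) = there (≼-⇒ p)

record HeadApproximant {n} {Γ : Env n} {t σ} (Π : Γ ⊢ t ∶ σ) : Set where
  constructor headApproximant
  field
    {approx}   : Ne n
    {head}     : Fin n
    {headType} : Ty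
    {rest}     : Env n
    apx        : ApxOf Π (neu approx)
    approx⊑    : approx ⊑L t
    algorithm  : approx ⊩H⟨ head ∶ headType ⟩ rest , σ
    suffix     : σ ≼ headType
    env≈       : Γ ≈ₑ (rest +ₑ (head ∶ₑ (headType ∷ [])))

record Approximant {n} {Γ : Env n} {t σ} (Π : Γ ⊢ t ∶ σ) : Set where
  constructor approximant
  field
    {approx}  : Nf n
    apx       : ApxOf Π approx
    approx⊑   : approx ⊑N t
    algorithm : AlgT approx Γ σ

record Approximantₘ {n} {Δ : Env n} {u B} (Πs : Δ ⊢ₘ u ∶ B) : Set where
  constructor approximantₘ
  field
    {approxes} : List (Nf n)
    {env}      : Env n
    {type}     : MTy
    apx        : ApxList Πs approxes
    approxes⊑  : All (_⊑N u) approxes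
    env≈       : Δ ≈ₑ env
    type≃      : B ≃ₘ type
    premises   : UnionPrem approxes env type

head-to-approximant : ∀ {n} {Γ : Env n} {t σ} {Π : Γ ⊢ t ∶ σ} → HeadApproximant Π → Approximant Π
head-to-approximant (headApproximant apx L⊑ h suffix Γ≈) =
  approximant apx (neu⊑ L⊑) (_ , _ , ≈ₑ-refl , ≃-refl , Head suffix h Γ≈)

mutual
  find-head-approximant : ∀ {n} {Γ : Env n} {t σ} (Π : Γ ⊢ t ∶ σ) → ΠNormal Π → NotAbs t → HeadApproximant Π
  find-head-approximant (ax {x = x} {ρ = ρ}) _ _ =
    headApproximant ax𝒜 var⊑ Head₀ here (≈ₑ-sym (identityˡ (x ∶ₑ (ρ ∷ []))))
  find-head-approximant (→I Π) _ ¬abs = ⊥-elim (¬abs (_ , ≡-refl))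
  find-head-approximant (→E Π Πs A≃B) N _
    with find-head-approximant Π (→E-normal⁻-fun N) (→E-normal⁻-notAbs N)
       | find-approximantₘ Πs (→E-normal⁻-arg N)
  ... | headApproximant {head = x} {ρ} {Γ₀} apx L⊑ h suffix Γ≈ | approximantₘ {env = Δ'} apxs as⊑ Δ≈ B≃ prem
    with ⊑-lub _ as⊑
  ... | b , lub , b⊑ =
    headApproximant (→E𝒜 apx (m𝒜 apxs lub)) (app⊑ L⊑ b⊑)
      (Head>0 ≈ₑ-refl suffix h (Union prem lub) (trans A≃B B≃)) (≼-⇒ suffix)
      (≈ₑ-trans (∙-cong Γ≈ Δ≈) (xy∙z≈xz∙y Γ₀ (x ∶ₑ (ρ ∷ [])) Δ'))

  find-approximant : ∀ {n} {Γ : Env n} {t σ} (Π : Γ ⊢ t ∶ σ) → ΠNormal Π → Approximant Π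
  find-approximant Π@ax          N = head-to-approximant (find-head-approximant Π N λ ())
  find-approximant Π@(→E _ _ _) N = head-to-approximant (find-head-approximant Π N λ ())
  find-approximant (→I Π) N with find-approximant Π (→I-normal⁻ N)
  ... | approximant apx a⊑ (_ , _ , A≃ Pointwiseᵥ.∷ Γ≈ , τ≃ , d) =
    approximant (→I𝒜 apx) (ƛ⊑ a⊑) (_ , _ , Γ≈ , ⇒≃ A≃ τ≃ , Abs d)

  find-approximantₘ : ∀ {n} {Δ : Env n} {u B} (Πs : Δ ⊢ₘ u ∶ B) → ΠNormalₘ Πs → Approximantₘ Πs
  find-approximantₘ []ₘ _ = approximantₘ []𝒜 [] ≈ₑ-refl ≃ₘ-refl []U
  find-approximantₘ (Π ∷ₘ Πs) N
    with find-approximant Π (∷ₘ-normal⁻-head N) | find-approximantₘ Πs (∷ₘ-normal⁻-tail N)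
  ... | approximant apx a⊑ (_ , _ , Γ≈ , σ≃ , d) | approximantₘ apxs as⊑ Δ≈ A≃ prem =
    approximantₘ (∷𝒜 apx apxs) (a⊑ ∷ as⊑) (∙-cong Γ≈ Δ≈) (prep σ≃ A≃) (∷U d prem)

completeness : ∀ {n} {Γ : Env n} {t σ} → Typable Γ t σ →
               Σ (NormalTyping Γ t σ) λ nt → Approximant (NormalTyping.derivation nt)
completeness (_ , _ , Γ≈ , σ≃ , Π) with normalise Π (<-wellFounded (size Π))
... | normalTyping t→*t' Γ≈' σ≃' Π' N =
  normalTyping t→*t' (≈ₑ-trans Γ≈ Γ≈') (≃-trans σ≃ σ≃') Π' N , find-approximant Π' N

theorem3p19 : ∀ {n : ℕ} (Γ : Env n) (σ : Ty) →
    -- (1) soundness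
    (∀ (a : Nf n) (t : Tm n) → AlgT a Γ σ → nf a ⊑ t → Typable Γ t σ)
    ×
    -- (2) completeness
    (∀ (t : Tm n) → Typable Γ t σ →
      Σ (Tm n) λ t' → (t →β* t') ×
        Σ (Env n) λ Γ' → Σ Ty λ σ' → Γ ≈ₑ Γ' × σ ≃ σ' ×
          Σ (Γ' ⊢ t' ∶ σ') λ Π' → ΠNormal Π' ×
            Σ (Nf n) λ a → ApxOf Π' a × AlgT a Γ σ)
theorem3p19 Γ σ = (λ _ _ → soundness) , λ t typable → case completeness typable of λ where
  (normalTyping t→*t' Γ≈ σ≃ Π' N , approximant apx _ (_ , _ , Γ≈' , σ≃' , d)) →
    _ , t→*t' , _ , _ , Γ≈ , σ≃ , Π' , (λ {m} → N {m}) ,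
    _ , apx , _ , _ , ≈ₑ-trans Γ≈ Γ≈' , ≃-trans σ≃ σ≃' , d
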